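{- Let $X,Y$ be racks such that the pair $(X,Y)$ is productive and synchronized. Then the natural group homomorphism $\Gamma_{X\times Y}\to\Gamma_X\times\Gamma_Y\times\Gamma_{X_{\mathrm{triv}}\times Y_{\mathrm{triv}}}$ is injective.
   Context: A rack: set with $(x,y)\mapsto x^y$, each $x\mapsto x^y$ bijective, $(z^x)^y=(z^y)^{x^y}$; products are componentwise. $\Gamma_Z=\langle Z\mid y^{ -1}xy=x^y\rangle$. $Z_{\mathrm{triv}}$ is the set of connected components of $Z$ (classes of the smallest equivalence relation with $x\sim x^y$ for all $x,y$), viewed as a trivial rack ($a^b=a$), so $\Gamma_{X_{\mathrm{triv}}\times Y_{\mathrm{triv}}}$ is free abelian on $X_{\mathrm{triv}}\times Y_{\mathrm{triv}}$; the third component of the map is induced by $X\times Y\to X_{\mathrm{triv}}\times Y_{\mathrm{triv}}$. $(X,Y)$ is productive if the induced map $[\Gamma_{X\times Y},\Gamma_{X\times Y}]\to[\Gamma_X,\Gamma_X]\times[\Gamma_Y,\Gamma_Y]$ is injective, and synchronized if the natural map $(X\times Y)_{\mathrm{triv}}\to X_{\mathrm{triv}}\times Y_{\mathrm{triv}}$ is bijective. -}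

module Defs where

open import Level using (Level; _⊔_)
open import Data.Bool using (Bool; true; false; not)
open import Data.List using (List; []; _∷_; _++_; reverse; map; concat)
open import Data.Product using (_×_; _,_; proj₁; proj₂; ∃; Σ)
open import Relation.Binary.PropositionalEquality using (_≡_)
open import Function.Definitions using (Bijective; Injective; Surjective)

-- Racks: x ▷ y stands for x^y.

record Rack (a : Level) : Set (Level.suc a) where
  field
    Carrier : Set a
    _▷_     : Carrier → Carrier → Carrier
    bij     : ∀ y → Bijective _≡_ _≡_ (λ x → x ▷ y)
    selfdist : ∀ x y z → ((z ▷ x) ▷ y) ≡ ((z ▷ y) ▷ (x ▷ y))

open Rack public

_×ᴿ_ : ∀ {a b} → Rack a → Rack b → Rack (a ⊔ b)
_×ᴿ_ {a} {b} X Y = record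
  { Carrier = Carrier X × Carrier Y
  ; _▷_ = λ p q → (_▷_ X (proj₁ p) (proj₁ q) , _▷_ Y (proj₂ p) (proj₂ q))
  ; bij = λ q → inj q , surj q
  ; selfdist = λ p q r → cong₂' (selfdist X (proj₁ p) (proj₁ q) (proj₁ r))
                                (selfdist Y (proj₂ p) (proj₂ q) (proj₂ r))
  }
  where
  open import Relation.Binary.PropositionalEquality using (refl; cong₂)
  cong₂' : ∀ {A : Set a} {B : Set b} {a a' : A} {b b' : B} → a ≡ a' → b ≡ b' → (a , b) ≡ (a' , b')
  cong₂' refl refl = refl
  inj : ∀ q → Injective _≡_ _≡_ (λ p → (_▷_ X (proj₁ p) (proj₁ q) , _▷_ Y (proj₂ p) (proj₂ q)))
  inj q {x₁ , y₁} {x₂ , y₂} e =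
    cong₂' (proj₁ (bij X (proj₁ q)) (Relation.Binary.PropositionalEquality.cong proj₁ e))
           (proj₁ (bij Y (proj₂ q)) (Relation.Binary.PropositionalEquality.cong proj₂ e))
  surj : ∀ q → Surjective _≡_ _≡_ (λ p → (_▷_ X (proj₁ p) (proj₁ q) , _▷_ Y (proj₂ p) (proj₂ q)))
  surj q (u , v) with proj₂ (bij X (proj₁ q)) u | proj₂ (bij Y (proj₂ q)) v
  ... | (x , hx) | (y , hy) = (x , y) , λ { {x' , y'} refl → cong₂' (hx refl) (hy refl) }

data Conn {a} (Z : Rack a) : Carrier Z → Carrier Z → Set a where
  step  : ∀ x y → Conn Z x (_▷_ Z x y)
  crefl : ∀ x → Conn Z x x
  csym  : ∀ {x y} → Conn Z x y → Conn Z y x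
  ctrans : ∀ {x y z} → Conn Z x y → Conn Z y z → Conn Z x z

-- Group presentations by words.  A letter is a generator with a sign
-- (true = g, false = g⁻¹).

Word : ∀ {a} → Set a → Set a
Word A = List (Bool × A)

inv : ∀ {a} {A : Set a} → Word A → Word A
inv w = reverse (map (λ l → (not (proj₁ l) , proj₂ l)) w)

mapW : ∀ {a b} {A : Set a} {B : Set b} → (A → B) → Word A → Word B
mapW f = map (λ l → (proj₁ l , f (proj₂ l)))

-- The group ⟨ A | y⁻¹ x y = x ▷ y ⟩ where generators are additionally
-- identified along the relation R (R is _≡_ for an honest set of
-- generators; for a quotient set A/R it presents the group on A/R).
module Pres {a r} (A : Set a) (R : A → A → Set r) (_▷_ : A → A → A) where
  infix 4 _≈_
  data _≈_ : Word A → Word A → Set (a ⊔ r) where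
    ≈refl  : ∀ {u} → u ≈ u
    ≈sym   : ∀ {u v} → u ≈ v → v ≈ u
    ≈trans : ∀ {u v w} → u ≈ v → v ≈ w → u ≈ w
    ≈cong  : ∀ {u u' v v'} → u ≈ u' → v ≈ v' → (u ++ v) ≈ (u' ++ v')
    cancel₁ : ∀ x → ((true , x) ∷ (false , x) ∷ []) ≈ []
    cancel₂ : ∀ x → ((false , x) ∷ (true , x) ∷ []) ≈ []
    rel    : ∀ x y → ((false , y) ∷ (true , x) ∷ (true , y) ∷ []) ≈ ((true , x ▷ y) ∷ [])
    gen    : ∀ {x y} → R x y → ((true , x) ∷ []) ≈ ((true , y) ∷ [])

  comm : Word A → Word A → Word A
  comm u v = inv u ++ inv v ++ u ++ v

  InCommutator : Word A → Set (a ⊔ r)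
  InCommutator w = Σ (List (Word A × Word A))
                     (λ cs → w ≈ concat (map (λ p → comm (proj₁ p) (proj₂ p)) cs))

module Γ {a} (Z : Rack a) = Pres (Carrier Z) _≡_ (_▷_ Z)

-- Γ_{X_triv × Y_triv}: the group of the trivial rack on the set of pairs
-- of connected components, presented on representatives in X × Y.
module ΓTriv {a b} (X : Rack a) (Y : Rack b) =
  Pres (Carrier X × Carrier Y)
       (λ p q → Conn X (proj₁ p) (proj₁ q) × Conn Y (proj₂ p) (proj₂ q))
       (λ p q → p)

module _ {a b} (X : Rack a) (Y : Rack b) where
  private
    module ΓXY = Γ (X ×ᴿ Y)
    module ΓX  = Γ X
    module ΓY  = Γ Y
    module ΓT  = ΓTriv X Y

  πX : Word (Carrier X × Carrier Y) → Word (Carrier X)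
  πX = mapW proj₁
  πY : Word (Carrier X × Carrier Y) → Word (Carrier Y)
  πY = mapW proj₂

  Productive : Set (a ⊔ b)
  Productive = ∀ u v → ΓXY.InCommutator u → ΓXY.InCommutator v →
               ΓX._≈_ (πX u) (πX v) → ΓY._≈_ (πY u) (πY v) → ΓXY._≈_ u v

  -- (X×Y)_triv → X_triv × Y_triv is bijective (map induced by identity
  -- on representatives)
  Synchronized : Set (a ⊔ b)
  Synchronized = Bijective (Conn (X ×ᴿ Y))
                   (λ p q → Conn X (proj₁ p) (proj₁ q) × Conn Y (proj₂ p) (proj₂ q))
                   (λ p → p)

  NaturalMapInjective : Set (a ⊔ b)
  NaturalMapInjective = ∀ u v → ΓX._≈_ (πX u) (πX v) → ΓY._≈_ (πY u) (πY v) →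
                        ΓT._≈_ u v → ΓXY._≈_ u v

-- The trivial-rack group on X_triv × Y_triv is the abelianization of Γ_{X×Y} once
-- (X, Y) is synchronized: its defining relations only identify elements of Γ_{X×Y}
-- that agree modulo the commutator subgroup, since x ~ x^y there and connected
-- components of X × Y are those of X_triv × Y_triv.  So if u and v have the same
-- image in Γ_{X_triv×Y_triv}, then u v⁻¹ is a commutator element of Γ_{X×Y}; its
-- images in Γ_X and Γ_Y are trivial, and productivity forces u v⁻¹ = 1.
{-# OPTIONS --safe #-}
module Submission where

open import Level using (_⊔_)
open import Algebra.Bundles using (Group)
import Algebra.Properties.Group as GroupProperties
open import Data.Bool using (Bool; true; false; not)
open import Data.Bool.Properties using (not-involutive)
open import Data.List using ([]; _∷_; _++_; reverse; map; concat; [_])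
open import Data.List.Properties
  using (map-++; map-∘; map-cong; map-id; reverse-++; reverse-map; reverse-involutive;
         unfold-reverse; ++-assoc; ++-identityʳ; concat-++)
open import Data.Product using (_×_; _,_; proj₁; proj₂)
open import Function using (_∘_)
open import Relation.Binary.Bundles using (Setoid)
open import Relation.Binary.PropositionalEquality
  using (_≡_; refl; sym; trans; cong; cong₂; subst; module ≡-Reasoning)
import Relation.Binary.Reasoning.Setoid as SetoidReasoning
open import Defs

flipLetter : ∀ {a} {A : Set a} → Bool × A → Bool × A
flipLetter l = (not (proj₁ l) , proj₂ l)

module _ {a} {A : Set a} where

  flipLetter-involutive : ∀ (l : Bool × A) → flipLetter (flipLetter l) ≡ l
  flipLetter-involutive (s , x) = cong (_, x) (not-involutive s)

  inv-++ : ∀ (u v : Word A) → inv (u ++ v) ≡ inv v ++ inv u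
  inv-++ u v = trans (cong reverse (map-++ flipLetter u v))
                     (reverse-++ (map flipLetter u) (map flipLetter v))

  inv-∷ : ∀ l (u : Word A) → inv (l ∷ u) ≡ inv u ++ [ flipLetter l ]
  inv-∷ l u = unfold-reverse (flipLetter l) (map flipLetter u)

  inv-involutive : ∀ (u : Word A) → inv (inv u) ≡ u
  inv-involutive u = begin
    reverse (map flipLetter (reverse (map flipLetter u)))
      ≡⟨ cong reverse (reverse-map flipLetter (map flipLetter u)) ⟩
    reverse (reverse (map flipLetter (map flipLetter u)))
      ≡⟨ reverse-involutive _ ⟩
    map flipLetter (map flipLetter u)
      ≡⟨ sym (map-∘ u) ⟩
    map (flipLetter ∘ flipLetter) u
      ≡⟨ map-cong flipLetter-involutive u ⟩
    map (λ l → l) u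
      ≡⟨ map-id u ⟩
    u ∎
    where open ≡-Reasoning

  mapW-inv : ∀ {b} {B : Set b} (f : A → B) u → mapW f (inv u) ≡ inv (mapW f u)
  -- relabelling a letter and flipping its sign commute definitionally
  mapW-inv f u = begin
    mapW f (reverse (map flipLetter u))       ≡⟨ reverse-map _ (map flipLetter u) ⟩
    reverse (mapW f (map flipLetter u))       ≡⟨ cong reverse (trans (sym (map-∘ u)) (map-∘ u)) ⟩
    reverse (map flipLetter (mapW f u))       ∎
    where open ≡-Reasoning

  inv-comm : ∀ (u v : Word A) → inv (inv u ++ inv v ++ u ++ v) ≡ inv v ++ inv u ++ v ++ u
  inv-comm u v = begin
    inv (inv u ++ inv v ++ u ++ v)                 ≡⟨ inv-++ (inv u) _ ⟩
    inv (inv v ++ u ++ v) ++ inv (inv u)           ≡⟨ cong (_++ inv (inv u)) (inv-++ (inv v) _) ⟩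
    (inv (u ++ v) ++ inv (inv v)) ++ inv (inv u)   ≡⟨ cong (λ w → (w ++ inv (inv v)) ++ inv (inv u)) (inv-++ u v) ⟩
    ((inv v ++ inv u) ++ inv (inv v)) ++ inv (inv u)
      ≡⟨ cong₂ (λ w w′ → ((inv v ++ inv u) ++ w) ++ w′) (inv-involutive v) (inv-involutive u) ⟩
    ((inv v ++ inv u) ++ v) ++ u                   ≡⟨ ++-assoc (inv v ++ inv u) v u ⟩
    (inv v ++ inv u) ++ v ++ u                     ≡⟨ ++-assoc (inv v) (inv u) (v ++ u) ⟩
    inv v ++ inv u ++ v ++ u                       ∎
    where open ≡-Reasoning

module Presentation {a r} (A : Set a) (R : A → A → Set r) (_▷_ : A → A → A) where
  open Pres A R _▷_

  ≈-reflexive : ∀ {u v} → u ≡ v → u ≈ v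
  ≈-reflexive refl = ≈refl

  ≈-setoid : Setoid a (a ⊔ r)
  ≈-setoid = record
    { Carrier = Word A
    ; _≈_ = _≈_
    ; isEquivalence = record { refl = ≈refl ; sym = ≈sym ; trans = ≈trans }
    }

  open SetoidReasoning ≈-setoid

  inverseʳ : ∀ u → (u ++ inv u) ≈ []
  inverseʳ [] = ≈refl
  inverseʳ (l ∷ u) = begin
    l ∷ u ++ inv (l ∷ u)                   ≡⟨ cong (λ w → l ∷ u ++ w) (inv-∷ l u) ⟩
    [ l ] ++ u ++ inv u ++ [ flipLetter l ] ≡⟨ cong (l ∷_) (sym (++-assoc u (inv u) _)) ⟩
    [ l ] ++ (u ++ inv u) ++ [ flipLetter l ]
      ≈⟨ ≈cong (≈refl {[ l ]}) (≈cong (inverseʳ u) ≈refl) ⟩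
    l ∷ flipLetter l ∷ []                   ≈⟨ cancel l ⟩
    []                                      ∎
    where
    cancel : ∀ l → (l ∷ flipLetter l ∷ []) ≈ []
    cancel (true , x)  = cancel₁ x
    cancel (false , x) = cancel₂ x

  inverseˡ : ∀ u → (inv u ++ u) ≈ []
  inverseˡ u = subst (λ w → (inv u ++ w) ≈ []) (inv-involutive u) (inverseʳ (inv u))

  inv-cong : ∀ {u v} → u ≈ v → inv u ≈ inv v
  inv-cong {u} {v} u≈v = begin
    inv u                    ≡⟨ sym (++-identityʳ (inv u)) ⟩
    inv u ++ []              ≈⟨ ≈cong ≈refl (≈sym (inverseʳ v)) ⟩
    inv u ++ v ++ inv v      ≈⟨ ≈cong (≈refl {inv u}) (≈cong (≈sym u≈v) ≈refl) ⟩
    inv u ++ u ++ inv v      ≡⟨ sym (++-assoc (inv u) u (inv v)) ⟩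
    (inv u ++ u) ++ inv v    ≈⟨ ≈cong (inverseˡ u) ≈refl ⟩
    inv v                    ∎

  group : Group a (a ⊔ r)
  group = record
    { Carrier = Word A
    ; _≈_ = _≈_
    ; _∙_ = _++_
    ; ε = []
    ; _⁻¹ = inv
    ; isGroup = record
      { isMonoid = record
        { isSemigroup = record
          { isMagma = record { isEquivalence = Setoid.isEquivalence ≈-setoid ; ∙-cong = ≈cong }
          ; assoc = λ u v w → ≈-reflexive (++-assoc u v w)
          }
        ; identity = (λ _ → ≈refl) , (λ u → ≈-reflexive (++-identityʳ u))
        }
      ; inverse = inverseˡ , inverseʳ
      ; ⁻¹-cong = inv-cong
      }
    }

  open GroupProperties group public using (x∙y⁻¹≈ε⇒x≈y; x≈y⇒x∙y⁻¹≈ε)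

  InCommutator-resp-≈ : ∀ {u v} → u ≈ v → InCommutator u → InCommutator v
  InCommutator-resp-≈ u≈v (cs , u≈cs) = cs , ≈trans (≈sym u≈v) u≈cs

  InCommutator-[] : InCommutator []
  InCommutator-[] = [] , ≈refl

  InCommutator-comm : ∀ u v → InCommutator (comm u v)
  InCommutator-comm u v = [ (u , v) ] , ≈-reflexive (sym (++-identityʳ (comm u v)))

  InCommutator-++ : ∀ {u v} → InCommutator u → InCommutator v → InCommutator (u ++ v)
  InCommutator-++ (cs , u≈cs) (ds , v≈ds) = cs ++ ds , ≈trans (≈cong u≈cs v≈ds)
    (≈-reflexive (trans (concat-++ (map _ cs) (map _ ds)) (cong concat (sym (map-++ _ cs ds)))))

  InCommutator-inv : ∀ {u} → InCommutator u → InCommutator (inv u)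
  InCommutator-inv (cs , u≈cs) = InCommutator-resp-≈ (≈sym (inv-cong u≈cs)) (product cs)
    where
    product : ∀ cs → InCommutator (inv (concat (map (λ p → comm (proj₁ p) (proj₂ p)) cs)))
    product [] = InCommutator-[]
    product ((u , v) ∷ cs) =
      subst InCommutator (sym (trans (inv-++ (comm u v) _) (cong (_ ++_) (inv-comm u v))))
            (InCommutator-++ (product cs) (InCommutator-comm v u))

  -- g c g⁻¹ = c · [c, g⁻¹]
  InCommutator-conj : ∀ g {c} → InCommutator c → InCommutator (g ++ c ++ inv g)
  InCommutator-conj g {c} c∈C =
    InCommutator-resp-≈ c∙[c,g⁻¹]≈gcg⁻¹ (InCommutator-++ c∈C (InCommutator-comm c (inv g)))
    where
    c∙[c,g⁻¹]≈gcg⁻¹ : (c ++ comm c (inv g)) ≈ (g ++ c ++ inv g)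
    c∙[c,g⁻¹]≈gcg⁻¹ = begin
      c ++ inv c ++ inv (inv g) ++ c ++ inv g   ≡⟨ sym (++-assoc c (inv c) _) ⟩
      (c ++ inv c) ++ inv (inv g) ++ c ++ inv g ≈⟨ ≈cong (inverseʳ c) ≈refl ⟩
      inv (inv g) ++ c ++ inv g                 ≡⟨ cong (_++ c ++ inv g) (inv-involutive g) ⟩
      g ++ c ++ inv g                           ∎

  infix 4 _∼_
  record _∼_ (u v : Word A) : Set (a ⊔ r) where
    constructor mk∼
    field ∼⇒InCommutator : InCommutator (u ++ inv v)
  open _∼_ public

  ≈⇒∼ : ∀ {u v} → u ≈ v → u ∼ v
  ≈⇒∼ u≈v = mk∼ (InCommutator-resp-≈ (≈sym (x≈y⇒x∙y⁻¹≈ε u≈v)) InCommutator-[])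

  ∼-sym : ∀ {u v} → u ∼ v → v ∼ u
  ∼-sym {u} {v} (mk∼ u∼v) = mk∼
    (subst InCommutator (trans (inv-++ u (inv v)) (cong (_++ inv u) (inv-involutive v)))
           (InCommutator-inv u∼v))

  ∼-trans : ∀ {u v w} → u ∼ v → v ∼ w → u ∼ w
  ∼-trans {u} {v} {w} (mk∼ u∼v) (mk∼ v∼w) =
    mk∼ (InCommutator-resp-≈ cancel-v (InCommutator-++ u∼v v∼w))
    where
    cancel-v : ((u ++ inv v) ++ v ++ inv w) ≈ (u ++ inv w)
    cancel-v = begin
      (u ++ inv v) ++ v ++ inv w  ≡⟨ ++-assoc u (inv v) _ ⟩
      u ++ inv v ++ v ++ inv w    ≡⟨ cong (u ++_) (sym (++-assoc (inv v) v (inv w))) ⟩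
      u ++ (inv v ++ v) ++ inv w  ≈⟨ ≈cong (≈refl {u}) (≈cong (inverseˡ v) ≈refl) ⟩
      u ++ inv w                  ∎

  -- (u v)(u′ v′)⁻¹ = u (v v′⁻¹) u⁻¹ · u u′⁻¹
  ∼-cong : ∀ {u u′ v v′} → u ∼ u′ → v ∼ v′ → (u ++ v) ∼ (u′ ++ v′)
  ∼-cong {u} {u′} {v} {v′} (mk∼ u∼u′) (mk∼ v∼v′) =
    mk∼ (InCommutator-resp-≈ regroup (InCommutator-++ (InCommutator-conj u v∼v′) u∼u′))
    where
    regroup : ((u ++ (v ++ inv v′) ++ inv u) ++ u ++ inv u′) ≈ ((u ++ v) ++ inv (u′ ++ v′))
    regroup = begin
      (u ++ (v ++ inv v′) ++ inv u) ++ u ++ inv u′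
        ≡⟨ trans (++-assoc u _ _) (cong (u ++_) (++-assoc (v ++ inv v′) (inv u) _)) ⟩
      u ++ (v ++ inv v′) ++ inv u ++ u ++ inv u′
        ≡⟨ cong (λ w → u ++ (v ++ inv v′) ++ w) (sym (++-assoc (inv u) u (inv u′))) ⟩
      u ++ (v ++ inv v′) ++ (inv u ++ u) ++ inv u′
        ≈⟨ ≈cong (≈refl {u}) (≈cong (≈refl {v ++ inv v′}) (≈cong (inverseˡ u) ≈refl)) ⟩
      u ++ (v ++ inv v′) ++ inv u′
        ≡⟨ cong (u ++_) (++-assoc v (inv v′) (inv u′)) ⟩
      u ++ v ++ inv v′ ++ inv u′
        ≡⟨ sym (++-assoc u v _) ⟩
      (u ++ v) ++ inv v′ ++ inv u′
        ≡⟨ cong ((u ++ v) ++_) (sym (inv-++ u′ v′)) ⟩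
      (u ++ v) ++ inv (u′ ++ v′) ∎

  mapW-x≈y⇒x∙y⁻¹≈ε : ∀ {b} {B : Set b} (f : B → A) u v →
                     mapW f u ≈ mapW f v → mapW f (u ++ inv v) ≈ []
  mapW-x≈y⇒x∙y⁻¹≈ε f u v fu≈fv = begin
    mapW f (u ++ inv v)           ≡⟨ trans (map-++ _ u (inv v)) (cong (mapW f u ++_) (mapW-inv f v)) ⟩
    mapW f u ++ inv (mapW f v)    ≈⟨ x≈y⇒x∙y⁻¹≈ε fu≈fv ⟩
    []                            ∎

module _ {a} (Z : Rack a) where
  open Pres (Carrier Z) _≡_ (_▷_ Z) using (≈refl; cancel₁; cancel₂; rel)
  open Presentation (Carrier Z) _≡_ (_▷_ Z)

  -- x (y⁻¹ x y)⁻¹ is literally the commutator [x⁻¹, y]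
  Conn⇒∼ : ∀ {x y} → Conn Z x y → [ (true , x) ] ∼ [ (true , y) ]
  Conn⇒∼ (step x y) = ∼-trans
    (mk∼ (InCommutator-comm [ (false , x) ] [ (true , y) ])) (≈⇒∼ (rel x y))
  Conn⇒∼ (crefl x)         = ≈⇒∼ ≈refl
  Conn⇒∼ (csym x~y)        = ∼-sym (Conn⇒∼ x~y)
  Conn⇒∼ (ctrans x~y y~z)  = ∼-trans (Conn⇒∼ x~y) (Conn⇒∼ y~z)

  module _ {r} (R : Carrier Z → Carrier Z → Set r) (R⇒Conn : ∀ {x y} → R x y → Conn Z x y) where
    private
      module Triv = Pres (Carrier Z) R (λ x _ → x)

    -- y⁻¹ x y x⁻¹ is literally the commutator [y, x⁻¹]
    trivial≈⇒∼ : ∀ {u v} → u Triv.≈ v → u ∼ v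
    trivial≈⇒∼ Triv.≈refl          = ≈⇒∼ ≈refl
    trivial≈⇒∼ (Triv.≈sym p)       = ∼-sym (trivial≈⇒∼ p)
    trivial≈⇒∼ (Triv.≈trans p q)   = ∼-trans (trivial≈⇒∼ p) (trivial≈⇒∼ q)
    trivial≈⇒∼ (Triv.≈cong p q)    = ∼-cong (trivial≈⇒∼ p) (trivial≈⇒∼ q)
    trivial≈⇒∼ (Triv.cancel₁ x)    = ≈⇒∼ (cancel₁ x)
    trivial≈⇒∼ (Triv.cancel₂ x)    = ≈⇒∼ (cancel₂ x)
    trivial≈⇒∼ (Triv.rel x y)      = mk∼ (InCommutator-comm [ (true , y) ] [ (false , x) ])
    trivial≈⇒∼ (Triv.gen x~y)      = Conn⇒∼ (R⇒Conn x~y)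

mainTheorem11 : ∀ {a b} (X : Rack a) (Y : Rack b) →
    Productive X Y → Synchronized X Y → NaturalMapInjective X Y
mainTheorem11 X Y productive synchronized u v πXu≈πXv πYu≈πYv u≈v =
  x∙y⁻¹≈ε⇒x≈y u v
    (productive (u ++ inv v) []
      (∼⇒InCommutator (trivial≈⇒∼ (X ×ᴿ Y) _ (proj₁ synchronized) u≈v))
      InCommutator-[]
      (Presentation.mapW-x≈y⇒x∙y⁻¹≈ε (Carrier X) _≡_ (_▷_ X) proj₁ u v πXu≈πXv)
      (Presentation.mapW-x≈y⇒x∙y⁻¹≈ε (Carrier Y) _≡_ (_▷_ Y) proj₂ u v πYu≈πYv))
  where open Presentation (Carrier (X ×ᴿ Y)) _≡_ (_▷_ (X ×ᴿ Y))
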